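{- For all $P,B:S\to\mathbb{B}$ and $C:S\to(E,S)\mathsf{itree}$: if $\{\lambda s.\,P(s)\wedge B(s)\}\,C\,\{P\}$ then $\{P\}\,\mathsf{while}\ B\ C\,\{\lambda s.\,\neg B(s)\wedge P(s)\}$.
   Context: Fix a type $E$ of events; $(E,S)\mathsf{itree}$ is the codatatype with constructors $\mathsf{Ret}\,r$, $\mathsf{Sil}\,P$ ($\tau P$), $\mathsf{Vis}\,F$ ($F:E\rightharpoonup(E,S)\mathsf{itree}$ partial). Bind: $\mathsf{Ret}\,r\mathbin{>\!\!>\!\!=}K=K\,r$, $\tau P'\mathbin{>\!\!>\!\!=}K=\tau(P'\mathbin{>\!\!>\!\!=}K)$, $\mathsf{Vis}\,F\mathbin{>\!\!>\!\!=}K=\mathsf{Vis}(\lambda e\in\mathrm{dom}(F)\bullet F(e)\mathbin{>\!\!>\!\!=}K)$. $\mathsf{while}\ B\ C\ s=$ if $B(s)$ then $\tau(C(s)\mathbin{>\!\!>\!\!=}\mathsf{while}\ B\ C)$ else $\mathsf{Ret}\,s$ (corecursive). Transition relation: least relation with $P\xrightarrow{[]}P$; $P\xrightarrow{tr}P'\Rightarrow\tau P\xrightarrow{tr}P'$; $e\in\mathrm{dom}(F)\wedge F(e)\xrightarrow{tr}P'\Rightarrow\mathsf{Vis}\,F\xrightarrow{e\#tr}P'$. Hoare triple: $\{P\}C\{Q\}\iff\forall s,s',tr.\,P(s)\wedge C(s)\xrightarrow{tr}\mathsf{Ret}\,s'\Rightarrow Q(s')$. -}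

module Defs where

open import Data.Bool using (Bool; true; false; if_then_else_)
open import Data.Maybe using (Maybe; just; nothing) renaming (map to mapMaybe)
open import Data.List using (List; []; _∷_)
open import Data.Sum using (_⊎_; inj₁; inj₂)
open import Data.Product using (Σ; _,_)
open import Relation.Binary.PropositionalEquality using (_≡_)

-- The tree denoted is the unfolding from the root state; the subtree at
-- state x is the unfolding from x.

data Step (E S X : Set) : Set where
  Ret : S → Step E S X
  Sil : X → Step E S X
  Vis : (E → Maybe X) → Step E S X

mapStep : ∀ {E S X Y : Set} → (X → Y) → Step E S X → Step E S Y
mapStep f (Ret s) = Ret s
mapStep f (Sil x) = Sil (f x)
mapStep f (Vis F) = Vis (λ e → mapMaybe f (F e))

record ITree (E S : Set) : Set₁ where
  field
    State : Set
    root  : State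
    step  : State → Step E S State

open ITree public

-- Bind:  Ret r >>= K = K r ;  τ P' >>= K = τ (P' >>= K) ;
--        Vis F >>= K = Vis (λ e ∈ dom F • F e >>= K)
-- States: inj₁ x  ~ (subtree of P at x) >>= K
--         inj₂ (r , y) ~ subtree of K r at y

bindStep : ∀ {E R S : Set} (P : ITree E R) (K : R → ITree E S) →
  State P ⊎ Σ R (λ r → State (K r)) →
  Step E S (State P ⊎ Σ R (λ r → State (K r)))
bindStep P K (inj₁ x) with step P x
... | Ret r = mapStep (λ y → inj₂ (r , y)) (step (K r) (root (K r)))
... | Sil x' = Sil (inj₁ x')
... | Vis F = Vis (λ e → mapMaybe inj₁ (F e))
bindStep P K (inj₂ (r , y)) = mapStep (λ y' → inj₂ (r , y')) (step (K r) y)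

bind : ∀ {E R S : Set} → ITree E R → (R → ITree E S) → ITree E S
bind {E} {R} {S} P K = record
  { State = State P ⊎ Σ R (λ r → State (K r))
  ; root  = inj₁ (root P)
  ; step  = bindStep P K
  }

-- while B C s = if B s then τ (C s >>= while B C) else Ret s
-- (corecursive).  States: inj₁ s ~ while B C s ;
--                         inj₂ (s , x) ~ (subtree of C s at x) >>= while B C

whileStart : ∀ {E S : Set} (B : S → Bool) (C : S → ITree E S) →
  S → Step E S (S ⊎ Σ S (λ s → State (C s)))
whileStart B C s = if B s then Sil (inj₂ (s , root (C s))) else Ret s

whileStep : ∀ {E S : Set} (B : S → Bool) (C : S → ITree E S) →
  S ⊎ Σ S (λ s → State (C s)) → Step E S (S ⊎ Σ S (λ s → State (C s)))
whileStep B C (inj₁ s) = whileStart B C s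
whileStep B C (inj₂ (s , x)) with step (C s) x
... | Ret r = whileStart B C r
... | Sil x' = Sil (inj₂ (s , x'))
... | Vis F = Vis (λ e → mapMaybe (λ x' → inj₂ (s , x')) (F e))

while : ∀ {E S : Set} → (S → Bool) → (S → ITree E S) → S → ITree E S
while {E} {S} B C s = record
  { State = S ⊎ Σ S (λ s → State (C s))
  ; root  = inj₁ s
  ; step  = whileStep B C
  }

data Trans {E S : Set} (T : ITree E S) : State T → List E → State T → Set where
  trefl : ∀ {x} → Trans T x [] x
  tsil  : ∀ {x y z tr} → step T x ≡ Sil y → Trans T y tr z → Trans T x tr z
  tvis  : ∀ {x F e y z tr} → step T x ≡ Vis F → F e ≡ just y →
          Trans T y tr z → Trans T x (e ∷ tr) z

Hoare : ∀ {E S : Set} → (S → Bool) → (S → ITree E S) → (S → Bool) → Set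
Hoare {E} {S} P C Q =
  ∀ (s s' : S) (tr : List E) (x : State (C s)) →
  P s ≡ true → Trans (C s) (root (C s)) tr x → step (C s) x ≡ Ret s' →
  Q s' ≡ true

-- The loop invariant is P at loop heads, and, while the body runs from a
-- state s, the entry condition P s ∧ B s together with reachability of
-- the current body state from the body's root.  It is preserved by every
-- silent and visible step of the unfolded loop; a loop-head step that
-- returns s' does so only when B s' is false, and a body that returns r
-- hands P r back by the hypothesis on C.
module Submission where

open import Defs
open import Data.Bool using (Bool; true; false; _∧_; not)
open import Data.Bool.Properties using (∧-identityʳ)
open import Data.Empty using (⊥-elim)
open import Data.Maybe using (just; nothing)
open import Data.List using ([]; _∷_; _++_)
open import Data.Product using (Σ; ∃; _×_; _,_)
open import Data.Sum using (_⊎_; inj₁; inj₂)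
open import Relation.Binary.PropositionalEquality using (_≡_; refl; trans)
open import Relation.Nullary using (¬_)

module _ {E S : Set} (T : ITree E S) where

  Trans-++ : ∀ {x y z tr tr′} →
    Trans T x tr y → Trans T y tr′ z → Trans T x (tr ++ tr′) z
  Trans-++ trefl        u = u
  Trans-++ (tsil p t)   u = tsil p (Trans-++ t u)
  Trans-++ (tvis p f t) u = tvis p f (Trans-++ t u)

  Reachable : State T → Set
  Reachable x = ∃ λ tr → Trans T (root T) tr x

  record Invariant (I : State T → Set) : Set where
    field
      sil-preserves : ∀ {x y} → step T x ≡ Sil y → I x → I y
      vis-preserves : ∀ {x F e y} → step T x ≡ Vis F → F e ≡ just y → I x → I y

  open Invariant

  Trans-preserves : ∀ {I} → Invariant I → ∀ {x tr y} → Trans T x tr y → I x → I y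
  Trans-preserves inv trefl        i = i
  Trans-preserves inv (tsil p t)   i = Trans-preserves inv t (sil-preserves inv p i)
  Trans-preserves inv (tvis p f t) i = Trans-preserves inv t (vis-preserves inv p f i)

  reachable-invariant : Invariant Reachable
  sil-preserves reachable-invariant p (tr , t) = tr ++ [] , Trans-++ t (tsil p trefl)
  vis-preserves reachable-invariant {e = e} p f (tr , t) =
    tr ++ e ∷ [] , Trans-++ t (tvis p f trefl)

open Invariant

module _ {E S : Set} (B : S → Bool) (C : S → ITree E S) where

  whileStart-sil : ∀ {r y} → whileStart B C r ≡ Sil y →
    B r ≡ true × y ≡ inj₂ (r , root (C r))
  whileStart-sil {r} eq with B r
  whileStart-sil refl | true = refl , refl

  whileStart-ret : ∀ {r s′} → whileStart B C r ≡ Ret s′ → B r ≡ false × s′ ≡ r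
  whileStart-ret {r} eq with B r
  whileStart-ret refl | false = refl , refl

  whileStart-vis : ∀ {r F} → ¬ whileStart B C r ≡ Vis F
  whileStart-vis {r} eq with B r
  whileStart-vis () | true
  whileStart-vis () | false

module _ {E S : Set} (P B : S → Bool) (C : S → ITree E S)
         (body : Hoare (λ s → P s ∧ B s) C P) where

  LoopInvariant : S ⊎ Σ S (λ s → State (C s)) → Set
  LoopInvariant (inj₁ s)       = P s ≡ true
  LoopInvariant (inj₂ (s , x)) = P s ∧ B s ≡ true × Reachable (C s) x

  body-post : ∀ {s x r} → LoopInvariant (inj₂ (s , x)) → step (C s) x ≡ Ret r →
    P r ≡ true
  body-post {s} {x} {r} (pb , tr , t) ret = body s r tr x pb t ret

  start-sil : ∀ {r y} → whileStart B C r ≡ Sil y → P r ≡ true → LoopInvariant y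
  start-sil {r} eq pr with whileStart-sil B C eq
  ... | br , refl = entry , [] , trefl
    where
      entry : P r ∧ B r ≡ true
      entry rewrite br = trans (∧-identityʳ (P r)) pr

  start-ret : ∀ {r s′} → whileStart B C r ≡ Ret s′ → P r ≡ true →
    not (B s′) ∧ P s′ ≡ true
  start-ret eq pr with whileStart-ret B C eq
  ... | br , refl rewrite br = pr

  loop-sil : ∀ {w y} → whileStep B C w ≡ Sil y → LoopInvariant w → LoopInvariant y
  loop-sil {inj₁ s} eq i = start-sil eq i
  loop-sil {inj₂ (s , x)} eq i with step (C s) x in ex
  ... | Ret r = start-sil eq (body-post i ex)
  loop-sil {inj₂ (s , x)} refl (pb , rx) | Sil x′ =
    pb , sil-preserves (reachable-invariant (C s)) ex rx
  loop-sil {inj₂ (s , x)} () i | Vis G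

  loop-vis : ∀ {w F e y} → whileStep B C w ≡ Vis F → F e ≡ just y →
    LoopInvariant w → LoopInvariant y
  loop-vis {inj₁ s} eq f i = ⊥-elim (whileStart-vis B C eq)
  loop-vis {inj₂ (s , x)} eq f i with step (C s) x in ex
  ... | Ret r = ⊥-elim (whileStart-vis B C eq)
  loop-vis {inj₂ (s , x)} () f i | Sil x′
  loop-vis {inj₂ (s , x)} {e = e} refl f (pb , rx) | Vis G with G e in ge
  ... | just x′ with refl ← f = pb , vis-preserves (reachable-invariant (C s)) ex ge rx
  loop-vis {inj₂ (s , x)} {e = e} refl () i | Vis G | nothing

  loop-invariant : ∀ {s₀} → Invariant (while B C s₀) LoopInvariant
  sil-preserves loop-invariant = loop-sil
  vis-preserves loop-invariant = loop-vis

  loop-exit : ∀ {w s′} → whileStep B C w ≡ Ret s′ → LoopInvariant w →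
    not (B s′) ∧ P s′ ≡ true
  loop-exit {inj₁ s} eq i = start-ret eq i
  loop-exit {inj₂ (s , x)} eq i with step (C s) x in ex
  ... | Ret r = start-ret eq (body-post i ex)
  loop-exit {inj₂ (s , x)} () i | Sil x′
  loop-exit {inj₂ (s , x)} () i | Vis G

theorem4p17 : {E S : Set} (P B : S → Bool) (C : S → ITree E S) →
    Hoare (λ s → P s ∧ B s) C P →
    Hoare P (while B C) (λ s → not (B s) ∧ P s)
theorem4p17 P B C body s s′ tr x ps run ret =
  loop-exit P B C body ret
    (Trans-preserves (while B C s) (loop-invariant P B C body) run ps)
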